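{- Let $n\geq 1$, $a=[n,n+1,n+2,n+3,n+4]$, and $b=F_nF_{n+1}F_{n+2}F_{n+3}F_{n+4}$. Then \[ z(b)=\begin{cases} a, & \text{if } n\equiv 1\pmod 3 \text{ or } n\equiv 2,3,5,6\pmod{12};\\ 2a, & \text{if } n\equiv 9,11\pmod{12};\\ \frac{72a}{(8,n)(9,n+1)}, & \text{if } n\equiv 8\pmod{12};\\ \frac{72a}{(8,n+4)(9,n+3)}, & \text{if } n\equiv 0\pmod{12}. \end{cases} \]
   Context: $F_n$ is the $n$th Fibonacci number ($F_1=F_2=1$, $F_n=F_{n-1}+F_{n-2}$). For a positive integer $m$, $z(m)$ is the smallest positive integer $k$ with $m\mid F_k$. $(\cdot,\cdot)$ denotes gcd and $[\cdots]$ lcm. -}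

module Defs where

open import Data.Nat using (ℕ; zero; suc; _+_; _*_; _<_; NonZero; ≢-nonZero)
open import Data.Nat.Divisibility using (_∣_)
open import Data.Nat.GCD using (gcd; gcd[m,n]≢0)
open import Data.Nat.LCM using (lcm)
open import Data.Nat.DivMod using (_/_)
open import Data.Nat.Properties using (m*n≢0)
open import Data.Sum using (inj₁)
open import Relation.Nullary using (¬_)
open import Data.Product using (_×_)

fib : ℕ → ℕ
fib zero = zero
fib (suc zero) = suc zero
fib (suc (suc n)) = fib (suc n) + fib n

IsRankOfApparition : ℕ → ℕ → Set
IsRankOfApparition m k = (0 < k) × (m ∣ fib k) × (∀ j → 0 < j → j < k → ¬ (m ∣ fib j))

gcd-suc-nonZero : ∀ m n → NonZero (gcd (suc m) n)
gcd-suc-nonZero m n = ≢-nonZero (gcd[m,n]≢0 (suc m) n (inj₁ λ ()))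

divGcds : ℕ → ℕ → ℕ → ℕ
divGcds x p q = _/_ x (gcd 8 p * gcd 9 q)
  {{m*n≢0 (gcd 8 p) (gcd 9 q) {{gcd-suc-nonZero 7 p}} {{gcd-suc-nonZero 8 q}}}}

lcm5 : ℕ → ℕ
lcm5 n = lcm n (lcm (n + 1) (lcm (n + 2) (lcm (n + 3) (n + 4))))

fibProd5 : ℕ → ℕ
fibProd5 n = fib n * fib (n + 1) * fib (n + 2) * fib (n + 3) * fib (n + 4)

-- Common divisors of fib x and fib (x + d) divide fib d, so two of fib n, …, fib (n + 4) can only
-- share the prime 2 = fib 3 (indices 3 apart, both divisible by 3) or 3 = fib 4 (indices 4 apart,
-- both divisible by 4). Hence b ∣ fib k iff fib (n + 2) and the pair products fib n fib (n + 3),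
-- fib (n + 1) fib (n + 4), fib n fib (n + 4) divide fib k. If a pair shares p = fib d, then p divides
-- one of its factors, fib x, exactly once, and by fib m ∣ fib k ⇔ m ∣ k and (for c ∣ fib m)
-- c fib m ∣ fib k ⇔ c m ∣ k the pair condition becomes x ∣ k and p y ∣ k for the other index y.
-- So z(b) is the lcm of a and these numbers p y, and each of them contributes the factor p exactly
-- when the p-adic valuation of y is not exceeded by that of any of n, …, n + 4. The residues of n
-- modulo 24 and 36 decide this, and the gcds (8, ·) and (9, ·) in the statement record the outcome.

module Submission where

open import Defs
open import Data.Nat
open import Data.Nat.Properties
open import Data.Nat.Divisibility
open import Data.Nat.DivMod
open import Data.Nat.GCD using (gcd; gcd[m,n]∣m; gcd[m,n]∣n; gcd-greatest)
open import Data.Nat.LCM using (lcm; m∣lcm[m,n]; n∣lcm[m,n]; lcm-least; gcd*lcm)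
open import Data.Nat.Coprimality as Coprimality using (Coprime; coprime-divisor; coprime?)
open import Data.Nat.Primality using (Prime; prime[2]; ¬prime[1]; prime?; prime⇒irreducible; euclidsLemma)
open import Data.Nat.Solver using (module +-*-Solver)
open import Data.Product using (Σ; ∃; _×_; _,_; proj₁; proj₂)
open import Data.Sum using (_⊎_; inj₁; inj₂; [_,_]′)
open import Data.Unit using (⊤; tt)
open import Function.Base using (id; flip)
open import Function.Bundles using (_⇔_; mk⇔; Equivalence)
open import Function.Properties.Equivalence using () renaming (refl to ⇔-refl; trans to ⇔-trans)
open import Data.Product.Function.NonDependent.Propositional using (_×-⇔_)
open import Relation.Nullary using (¬_; contradiction; Dec; yes; no)
open import Relation.Nullary.Decidable using (from-yes; from-no)
open import Relation.Binary.PropositionalEquality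

open +-*-Solver
open Equivalence

-- Divisibility and coprimality

prime[3] : Prime 3
prime[3] = from-yes (prime? 3)

prime∤⇒coprime : ∀ {p n} → Prime p → ¬ p ∣ n → Coprime n p
prime∤⇒coprime prime[p] p∤n (d∣n , d∣p) with prime⇒irreducible prime[p] d∣p
... | inj₁ d≡1 = d≡1
... | inj₂ refl = contradiction d∣n p∤n

prime∣*∧∤⇒∣ : ∀ {p m n} → Prime p → p ∣ m * n → ¬ p ∣ n → p ∣ m
prime∣*∧∤⇒∣ {m = m} {n} prime[p] p∣mn p∤n = [ id , flip contradiction p∤n ]′ (euclidsLemma m n prime[p] p∣mn)

coprime-*ʳ : ∀ {a b c} → Coprime a b → Coprime a c → Coprime a (b * c)
coprime-*ʳ {a} {b} coprime[a,b] coprime[a,c] (d∣a , d∣bc) =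
  coprime[a,c] (d∣a , coprime-divisor coprime[d,b] d∣bc)
  where
  coprime[d,b] : Coprime _ b
  coprime[d,b] (e∣d , e∣b) = coprime[a,b] (∣-trans e∣d d∣a , e∣b)

coprime-*ˡ : ∀ {a b c} → Coprime a c → Coprime b c → Coprime (a * b) c
coprime-*ˡ coprime[a,c] coprime[b,c] =
  Coprimality.sym (coprime-*ʳ (Coprimality.sym coprime[a,c]) (Coprimality.sym coprime[b,c]))

coprime-^ʳ : ∀ {a b} t → Coprime a b → Coprime a (b ^ t)
coprime-^ʳ zero    _            (_ , d∣1) = ∣1⇒≡1 d∣1
coprime-^ʳ (suc t) coprime[a,b] = coprime-*ʳ coprime[a,b] (coprime-^ʳ t coprime[a,b])

coprime⇒*∣ : ∀ {m n o} → Coprime m n → m ∣ o → n ∣ o → m * n ∣ o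
coprime⇒*∣ {m} {n} coprime[m,n] (divides q refl) n∣qm =
  subst (m * n ∣_) (*-comm m q) (*-monoʳ-∣ m (coprime-divisor (Coprimality.sym coprime[m,n]) (subst (n ∣_) (*-comm q m) n∣qm)))

coprime⇒*∣⇔ : ∀ {m n o} → Coprime m n → m * n ∣ o ⇔ (m ∣ o × n ∣ o)
coprime⇒*∣⇔ {m} {n} coprime[m,n] = mk⇔ (λ mn∣o → ∣-trans (m∣m*n n) mn∣o , ∣-trans (n∣m*n m) mn∣o)
                                         (λ (m∣o , n∣o) → coprime⇒*∣ coprime[m,n] m∣o n∣o)

*∣∧*∣⇒**∣ : ∀ {m n o d} → Coprime n o → m * n ∣ d → m * o ∣ d → m * n * o ∣ d
*∣∧*∣⇒**∣ {zero}  {n} {o} _ 0∣d _ = subst (λ d → 0 ∣ d) (sym (0∣⇒≡0 0∣d)) (0 ∣0)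
*∣∧*∣⇒**∣ {m@(suc _)} {n} {o} coprime[n,o] (divides q refl) mo∣qmn =
  subst (m * n * o ∣_) (*-comm (m * n) q) (*-monoʳ-∣ (m * n) o∣q)
  where
  o∣qn : o ∣ n * q
  o∣qn = *-cancelˡ-∣ m (subst (m * o ∣_) (solve 3 (λ q m n → q :* (m :* n) := m :* (n :* q)) refl q m n) mo∣qmn)
  o∣q : o ∣ q
  o∣q = coprime-divisor (Coprimality.sym coprime[n,o]) o∣qn

-- Under these hypotheses a prime divides at most two of the factors, and then one of the pairs
-- (a,d), (b,e), (a,e).
*∣-five⇔ : ∀ {a b c d e N} →
  Coprime a b → Coprime a c → Coprime b c → Coprime b d → Coprime c d → Coprime c e → Coprime d e →
  a * b * c * d * e ∣ N ⇔ (a * d ∣ N × b * e ∣ N × a * e ∣ N × c ∣ N)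
*∣-five⇔ {a} {b} {c} {d} {e} {N} ab ac bc bd cd ce de = mk⇔ pairs∣N product∣N
  where
  pairs∣N : a * b * c * d * e ∣ N → a * d ∣ N × b * e ∣ N × a * e ∣ N × c ∣ N
  pairs∣N abcde∣N = ∣-trans ad∣ abcde∣N , ∣-trans be∣ abcde∣N , ∣-trans ae∣ abcde∣N , ∣-trans c∣ abcde∣N
    where
    ad∣ : a * d ∣ a * b * c * d * e
    ad∣ = divides (b * c * e) (solve 5 (λ a b c d e → a :* b :* c :* d :* e := b :* c :* e :* (a :* d)) refl a b c d e)
    be∣ : b * e ∣ a * b * c * d * e
    be∣ = divides (a * c * d) (solve 5 (λ a b c d e → a :* b :* c :* d :* e := a :* c :* d :* (b :* e)) refl a b c d e)
    ae∣ : a * e ∣ a * b * c * d * e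
    ae∣ = divides (b * c * d) (solve 5 (λ a b c d e → a :* b :* c :* d :* e := b :* c :* d :* (a :* e)) refl a b c d e)
    c∣ : c ∣ a * b * c * d * e
    c∣ = divides (a * b * d * e) (solve 5 (λ a b c d e → a :* b :* c :* d :* e := a :* b :* d :* e :* c) refl a b c d e)
  product∣N : a * d ∣ N × b * e ∣ N × a * e ∣ N × c ∣ N → a * b * c * d * e ∣ N
  product∣N (ad∣N , be∣N , ae∣N , c∣N) =
    subst (_∣ N) (solve 5 (λ a b c d e → e :* (a :* d) :* b :* c := a :* b :* c :* d :* e) refl a b c d e) eadbc∣N
    where
    ade∣N : a * d * e ∣ N
    ade∣N = *∣∧*∣⇒**∣ {a} de ad∣N ae∣N
    eadb∣N : e * (a * d) * b ∣ N
    eadb∣N = *∣∧*∣⇒**∣ {e} (coprime-*ˡ ab (Coprimality.sym bd))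
               (subst (_∣ N) (*-comm (a * d) e) ade∣N) (subst (_∣ N) (*-comm b e) be∣N)
    eadbc∣N : e * (a * d) * b * c ∣ N
    eadbc∣N = coprime⇒*∣ (coprime-*ˡ (coprime-*ˡ (Coprimality.sym ce) (coprime-*ˡ ac (Coprimality.sym cd))) bc) eadb∣N c∣N

implied⇒×⇔ : ∀ {A B : Set} → (A → B) → (A × B) ⇔ A
implied⇒×⇔ A⇒B = mk⇔ proj₁ (λ a → a , A⇒B a)

-- Congruences

%-cong-+ : ∀ {x y u v} M .{{_ : NonZero M}} → x % M ≡ y % M → u % M ≡ v % M → (x + u) % M ≡ (y + v) % M
%-cong-+ {x} {y} {u} {v} M x≈y u≈v = begin
  (x + u) % M             ≡⟨ %-distribˡ-+ x u M ⟩
  (x % M + u % M) % M     ≡⟨ cong₂ (λ a b → (a + b) % M) x≈y u≈v ⟩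
  (y % M + v % M) % M     ≡⟨ %-distribˡ-+ y v M ⟨
  (y + v) % M             ∎
  where open ≡-Reasoning

%-cong-*ʳ : ∀ {x y} M z .{{_ : NonZero M}} → x % M ≡ y % M → (x * z) % M ≡ (y * z) % M
%-cong-*ʳ {x} {y} M z x≈y = begin
  (x * z) % M             ≡⟨ %-distribˡ-* x z M ⟩
  (x % M * (z % M)) % M   ≡⟨ cong (λ a → (a * (z % M)) % M) x≈y ⟩
  (y % M * (z % M)) % M   ≡⟨ %-distribˡ-* y z M ⟨
  (y * z) % M             ∎
  where open ≡-Reasoning

∣-%-transport : ∀ {c x y M} .{{_ : NonZero M}} → c ∣ M → x % M ≡ y % M → c ∣ x → c ∣ y
∣-%-transport c∣M x≈y c∣x = ∣n∣m%n⇒∣m c∣M (subst (_ ∣_) x≈y (%-presˡ-∣ c∣x c∣M))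

%-weaken : ∀ x {s} M d .{{_ : NonZero M}} .{{_ : NonZero d}} → M % d ≡ 0 → x % M ≡ s → x % d ≡ s % d
%-weaken x {s} M d M%d≡0 x%M≡s = trans (sym (m∣n⇒o%n%m≡o%m d M x (m%n≡0⇒n∣m M d M%d≡0))) (cong (_% d) x%M≡s)

%-refine : ∀ n {r} M t .{{_ : NonZero M}} .{{_ : NonZero (t * M)}} → n % M ≡ r →
  ∃ λ j → j < t × n % (t * M) ≡ r + j * M
%-refine n {r} M t n%M≡r = s / M , m<n*o⇒m/o<n (m%n<n n (t * M)) , (begin
  s                       ≡⟨ m≡m%n+[m/n]*n s M ⟩
  s % M + s / M * M       ≡⟨ cong (_+ s / M * M) (trans (m∣n⇒o%n%m≡o%m M (t * M) n (n∣m*n t)) n%M≡r) ⟩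
  r + s / M * M           ∎)
  where
  s : ℕ
  s = n % (t * M)
  open ≡-Reasoning

gcd-% : ∀ m n .{{_ : NonZero m}} → gcd m n ≡ gcd m (n % m)
gcd-% m n = ∣-antisym
  (gcd-greatest (gcd[m,n]∣m m n) (%-presˡ-∣ (gcd[m,n]∣n m n) (gcd[m,n]∣m m n)))
  (gcd-greatest (gcd[m,n]∣m m (n % m)) (∣n∣m%n⇒∣m (gcd[m,n]∣m m (n % m)) (gcd[m,n]∣n m (n % m))))

-- Divisibility of n + i by divisors d of M, read off from the residue r of n modulo M: for concrete
-- r, i, d and M the remaining hypotheses are closed equations, proved by refl.
module Residue (n M r : ℕ) .{{_ : NonZero M}} (n%M≡r : n % M ≡ r) where

  private
    [n+i]%M : ∀ i → (n + i) % M ≡ (r + i) % M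
    [n+i]%M i = trans (%-cong-+ M (sym (m%n%n≡m%n n M)) refl) (cong (λ s → (s + i) % M) n%M≡r)

    ∣-by-% : ∀ x {s} d .{{_ : NonZero d}} → M % d ≡ 0 → x % M ≡ s → s % d ≡ 0 → d ∣ x
    ∣-by-% x d M%d≡0 x%M≡s s%d≡0 = m%n≡0⇒n∣m x d (trans (%-weaken x M d M%d≡0 x%M≡s) s%d≡0)

    ∤-by-% : ∀ x {s j} d .{{_ : NonZero d}} → M % d ≡ 0 → x % M ≡ s → s % d ≡ suc j → ¬ d ∣ x
    ∤-by-% x d M%d≡0 x%M≡s s%d≡1+j d∣x =
      0≢1+n (trans (sym (n∣m⇒m%n≡0 x d d∣x)) (trans (%-weaken x M d M%d≡0 x%M≡s) s%d≡1+j))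

  ∣n : ∀ d .{{_ : NonZero d}} → M % d ≡ 0 → r % d ≡ 0 → d ∣ n
  ∣n d M%d≡0 = ∣-by-% n d M%d≡0 n%M≡r

  ∤n : ∀ d {j} .{{_ : NonZero d}} → M % d ≡ 0 → r % d ≡ suc j → ¬ d ∣ n
  ∤n d M%d≡0 = ∤-by-% n d M%d≡0 n%M≡r

  ∣n+ : ∀ i d .{{_ : NonZero d}} → M % d ≡ 0 → (r + i) % M % d ≡ 0 → d ∣ n + i
  ∣n+ i d M%d≡0 = ∣-by-% (n + i) d M%d≡0 ([n+i]%M i)

  ∤n+ : ∀ i d {j} .{{_ : NonZero d}} → M % d ≡ 0 → (r + i) % M % d ≡ suc j → ¬ d ∣ n + i
  ∤n+ i d M%d≡0 = ∤-by-% (n + i) d M%d≡0 ([n+i]%M i)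

  gcd-n : ∀ d .{{_ : NonZero d}} → M % d ≡ 0 → gcd d n ≡ gcd d (r % d)
  gcd-n d M%d≡0 = trans (gcd-% d n) (cong (gcd d) (%-weaken n M d M%d≡0 n%M≡r))

  gcd-n+ : ∀ i d .{{_ : NonZero d}} → M % d ≡ 0 → gcd d (n + i) ≡ gcd d ((r + i) % M % d)
  gcd-n+ i d M%d≡0 = trans (gcd-% d (n + i)) (cong (gcd d) (%-weaken (n + i) M d M%d≡0 ([n+i]%M i)))

residue≥3 : ∀ {n r} M .{{_ : NonZero M}} → n % M ≡ 3 + r → 3 ≤ n
residue≥3 {n} {r} M n%M≡3+r = ≤-trans (m≤m+n 3 r) (subst (_≤ n) n%M≡3+r (m%n≤m n M))

-- Least common multiples

lcm-∣⇔ : ∀ {m n k} → lcm m n ∣ k ⇔ (m ∣ k × n ∣ k)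
lcm-∣⇔ {m} {n} = mk⇔ (λ lcm∣k → ∣-trans (m∣lcm[m,n] m n) lcm∣k , ∣-trans (n∣lcm[m,n] m n) lcm∣k)
                     (λ (m∣k , n∣k) → lcm-least m∣k n∣k)

lcm5∣⇔ : ∀ n {k} → lcm5 n ∣ k ⇔ (n ∣ k × n + 1 ∣ k × n + 2 ∣ k × n + 3 ∣ k × n + 4 ∣ k)
lcm5∣⇔ n = ⇔-trans lcm-∣⇔ (⇔-refl ×-⇔ ⇔-trans lcm-∣⇔ (⇔-refl ×-⇔ ⇔-trans lcm-∣⇔ (⇔-refl ×-⇔ lcm-∣⇔)))

module Lcm5Divisors (n : ℕ) where
  private
    divisors : n ∣ lcm5 n × n + 1 ∣ lcm5 n × n + 2 ∣ lcm5 n × n + 3 ∣ lcm5 n × n + 4 ∣ lcm5 n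
    divisors = to (lcm5∣⇔ n) ∣-refl
  n∣lcm5 : n ∣ lcm5 n
  n∣lcm5 = proj₁ divisors
  n+1∣lcm5 : n + 1 ∣ lcm5 n
  n+1∣lcm5 = proj₁ (proj₂ divisors)
  n+2∣lcm5 : n + 2 ∣ lcm5 n
  n+2∣lcm5 = proj₁ (proj₂ (proj₂ divisors))
  n+3∣lcm5 : n + 3 ∣ lcm5 n
  n+3∣lcm5 = proj₁ (proj₂ (proj₂ (proj₂ divisors)))
  n+4∣lcm5 : n + 4 ∣ lcm5 n
  n+4∣lcm5 = proj₂ (proj₂ (proj₂ (proj₂ divisors)))

lcm>0 : ∀ {m n} → m > 0 → n > 0 → lcm m n > 0
lcm>0 {m} {n} m>0 n>0 = n≢0⇒n>0 lcm≢0
  where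
  lcm≢0 : lcm m n ≢ 0
  lcm≢0 lcm≡0 with m*n≡0⇒m≡0∨n≡0 m (trans (sym (gcd*lcm m n)) (trans (cong (gcd m n *_) lcm≡0) (*-zeroʳ (gcd m n))))
  ... | inj₁ m≡0 = contradiction m≡0 (>⇒≢ m>0)
  ... | inj₂ n≡0 = contradiction n≡0 (>⇒≢ n>0)

lcm5>0 : ∀ {n} → n > 0 → lcm5 n > 0
lcm5>0 {n} n>0 =
  lcm>0 n>0 (lcm>0 (m≤n⇒m≤n+o 1 n>0) (lcm>0 (m≤n⇒m≤n+o 2 n>0) (lcm>0 (m≤n⇒m≤n+o 3 n>0) (m≤n⇒m≤n+o 4 n>0))))

-- Divisibility of Fibonacci numbers

fib-+ : ∀ m n → fib (suc (m + n)) ≡ fib (suc m) * fib (suc n) + fib m * fib n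
fib-+ zero n = solve 1 (λ x → x := con 1 :* x :+ con 0) refl (fib (suc n))
fib-+ (suc m) n = begin
  fib (suc (suc m + n))                                     ≡⟨ cong (λ k → fib (suc k)) (+-suc m n) ⟨
  fib (suc (m + suc n))                                     ≡⟨ fib-+ m (suc n) ⟩
  fib (suc m) * (fib (suc n) + fib n) + fib m * fib (suc n) ≡⟨ regroup (fib (suc m)) (fib m) (fib (suc n)) (fib n) ⟩
  fib (suc (suc m)) * fib (suc n) + fib (suc m) * fib n     ∎
  where
  open ≡-Reasoning
  regroup : ∀ a b c d → a * (c + d) + b * c ≡ (a + b) * c + a * d
  regroup = solve 4 (λ a b c d → a :* (c :+ d) :+ b :* c := (a :+ b) :* c :+ a :* d) refl

fib[1+n]>0 : ∀ n → fib (suc n) > 0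
fib[1+n]>0 zero    = s≤s z≤n
fib[1+n]>0 (suc n) = ≤-trans (fib[1+n]>0 n) (m≤m+n _ _)

fib-≤-suc : ∀ n → fib n ≤ fib (suc n)
fib-≤-suc zero    = z≤n
fib-≤-suc (suc n) = m≤m+n _ _

fib-mono-≤ : ∀ {m n} → m ≤ n → fib m ≤ fib n
fib-mono-≤ m≤n = mono (≤⇒≤′ m≤n)
  where
  mono : ∀ {m n} → m ≤′ n → fib m ≤ fib n
  mono ≤′-refl            = ≤-refl
  mono (≤′-step {n} m≤′n) = ≤-trans (mono m≤′n) (fib-≤-suc n)

fib-< : ∀ {r m} → r < m → 3 ≤ m → fib r < fib m
fib-< {r} {suc (suc (suc j))} (s≤s r≤2+j) (s≤s (s≤s (s≤s z≤n))) = begin-strict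
  fib r                                 ≤⟨ fib-mono-≤ r≤2+j ⟩
  fib (suc (suc j))                     <⟨ m<m+n _ (fib[1+n]>0 j) ⟩
  fib (suc (suc j)) + fib (suc j)       ∎
  where open ≤-Reasoning

fib-coprime-suc : ∀ n → Coprime (fib n) (fib (suc n))
fib-coprime-suc zero    (_ , d∣1) = ∣1⇒≡1 d∣1
fib-coprime-suc (suc n) (d∣fib[1+n] , d∣fib[2+n]) =
  fib-coprime-suc n (∣m+n∣m⇒∣n d∣fib[2+n] d∣fib[1+n] , d∣fib[1+n])

∣fib[m+n]∧∣fib[n]⇒∣fib[m] : ∀ m n {d} → d ∣ fib (m + n) → d ∣ fib n → d ∣ fib m
∣fib[m+n]∧∣fib[n]⇒∣fib[m] m zero    {d} d∣fib[m+0] _ = subst (λ k → d ∣ fib k) (+-identityʳ m) d∣fib[m+0]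
∣fib[m+n]∧∣fib[n]⇒∣fib[m] m (suc n) {d} d∣fib[m+1+n] d∣fib[1+n] = coprime-divisor coprime[d,fib[n]] d∣fib[n]*fib[m]
  where
  d∣sum : d ∣ fib (suc m) * fib (suc n) + fib m * fib n
  d∣sum = subst (d ∣_) (trans (cong fib (+-suc m n)) (fib-+ m n)) d∣fib[m+1+n]
  d∣fib[n]*fib[m] : d ∣ fib n * fib m
  d∣fib[n]*fib[m] = subst (d ∣_) (*-comm (fib m) (fib n)) (∣m+n∣m⇒∣n d∣sum (∣n⇒∣m*n (fib (suc m)) d∣fib[1+n]))
  coprime[d,fib[n]] : Coprime d (fib n)
  coprime[d,fib[n]] (e∣d , e∣fib[n]) = fib-coprime-suc n (e∣fib[n] , ∣-trans e∣d d∣fib[1+n])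

∣fib[k]∧∣fib[m]⇒∣fib[k%m] : ∀ k m .{{_ : NonZero m}} {d} → d ∣ fib k → d ∣ fib m → d ∣ fib (k % m)
∣fib[k]∧∣fib[m]⇒∣fib[k%m] k m {d} d∣fib[k] d∣fib[m] =
  peel (k % m) (k / m) (subst (λ i → d ∣ fib i) (m≡m%n+[m/n]*n k m) d∣fib[k])
  where
  peel : ∀ r t → d ∣ fib (r + t * m) → d ∣ fib r
  peel r zero    d∣fib[r+0] = subst (λ i → d ∣ fib i) (+-identityʳ r) d∣fib[r+0]
  peel r (suc t) d∣fib[r+[1+t]m] = peel r t (∣fib[m+n]∧∣fib[n]⇒∣fib[m] (r + t * m) m
    (subst (λ i → d ∣ fib i) (solve 3 (λ r t m → r :+ (con 1 :+ t) :* m := r :+ t :* m :+ m) refl r t m) d∣fib[r+[1+t]m])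
    d∣fib[m])

fib∣fib[m*n] : ∀ m n → fib m ∣ fib (m * n)
fib∣fib[m*n] m       zero    = subst (λ i → fib m ∣ fib i) (sym (*-zeroʳ m)) (fib m ∣0)
fib∣fib[m*n] zero    (suc n) = ∣-refl
fib∣fib[m*n] (suc m) (suc n) = subst (fib (suc m) ∣_) (sym fib[[1+m][1+n]])
  (∣m∣n⇒∣m+n (∣n⇒∣m*n (fib (suc (suc m * n))) ∣-refl) (∣m⇒∣m*n (fib m) (fib∣fib[m*n] (suc m) n)))
  where
  fib[[1+m][1+n]] : fib (suc m * suc n) ≡ fib (suc (suc m * n)) * fib (suc m) + fib (suc m * n) * fib m
  fib[[1+m][1+n]] = trans (cong fib (solve 2 (λ m n → (con 1 :+ m) :* (con 1 :+ n) := con 1 :+ ((con 1 :+ m) :* n :+ m)) refl m n))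
                          (fib-+ (suc m * n) m)

fib-mono-∣ : ∀ {m n} → m ∣ n → fib m ∣ fib n
fib-mono-∣ {m} (divides q refl) = subst (λ i → fib m ∣ fib i) (*-comm m q) (fib∣fib[m*n] m q)

fib∣fib⇔∣ : ∀ {m k} → 3 ≤ m → fib m ∣ fib k ⇔ m ∣ k
fib∣fib⇔∣ {m} {k} 3≤m = mk⇔ m∣k fib-mono-∣
  where
  instance
    m≢0 : NonZero m
    m≢0 = >-nonZero (≤-trans (s≤s z≤n) 3≤m)
  m∣k : fib m ∣ fib k → m ∣ k
  m∣k fib[m]∣fib[k] with k % m in k%m≡r | ∣fib[k]∧∣fib[m]⇒∣fib[k%m] k m fib[m]∣fib[k] ∣-refl
  ... | zero  | _ = m%n≡0⇒n∣m k m k%m≡r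
  ... | suc r | fib[m]∣fib[1+r] = contradiction (∣⇒≤ {{>-nonZero (fib[1+n]>0 r)}} fib[m]∣fib[1+r])
                                       (<⇒≱ (fib-< (subst (_< m) k%m≡r (m%n<n k m)) 3≤m))

module FibQuotient (m′ : ℕ) where
  private instance
    fib[1+m′]≢0 : NonZero (fib (suc m′))
    fib[1+m′]≢0 = >-nonZero (fib[1+n]>0 m′)

  -- Writing m = m′ + 1: q is fib (m t) / fib m, congruent to t * fib m′ ^ (t - 1) modulo fib m
  -- (stated multiplied by fib m′ to avoid t - 1).
  IsFibQuotient : ℕ → ℕ → Set
  IsFibQuotient t q =
      fib (suc m′ * t) ≡ fib (suc m′) * q
    × (q * fib m′) % fib (suc m′) ≡ (t * fib m′ ^ t) % fib (suc m′)
    × fib (suc (suc m′ * t)) % fib (suc m′) ≡ fib m′ ^ t % fib (suc m′)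

  fib-quotient-step : ∀ t q → IsFibQuotient t q → IsFibQuotient (suc t) (fib (suc (suc m′ * t)) + q * fib m′)
  fib-quotient-step t q (fib[mt]≡Fq , qG≈tGᵗ , fib[mt+1]≈Gᵗ) = fib[m[t+1]]≡ , q′G≈ , fib[m[t+1]+1]≈
    where
    open ≡-Reasoning
    m F G R : ℕ
    m = suc m′
    F = fib m
    G = fib m′
    R = fib (suc (m * t))
    fib[m[t+1]]≡ : fib (m * suc t) ≡ F * (R + q * G)
    fib[m[t+1]]≡ = begin
      fib (m * suc t)            ≡⟨ cong fib (solve 2 (λ m t → (con 1 :+ m) :* (con 1 :+ t) := con 1 :+ ((con 1 :+ m) :* t :+ m))
                                                     refl m′ t) ⟩
      fib (suc (m * t + m′))     ≡⟨ fib-+ (m * t) m′ ⟩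
      R * F + fib (m * t) * G    ≡⟨ cong (λ x → R * F + x * G) fib[mt]≡Fq ⟩
      R * F + F * q * G          ≡⟨ solve 4 (λ R F q G → R :* F :+ F :* q :* G := F :* (R :+ q :* G)) refl R F q G ⟩
      F * (R + q * G)            ∎
    q′G≈ : ((R + q * G) * G) % F ≡ (suc t * G ^ suc t) % F
    q′G≈ = begin
      ((R + q * G) * G) % F           ≡⟨ cong (_% F) (*-distribʳ-+ G R (q * G)) ⟩
      (R * G + q * G * G) % F         ≡⟨ %-cong-+ F (%-cong-*ʳ F G fib[mt+1]≈Gᵗ) (%-cong-*ʳ F G qG≈tGᵗ) ⟩
      (G ^ t * G + t * G ^ t * G) % F ≡⟨ cong (_% F) (solve 3 (λ P t G → P :* G :+ t :* P :* G := (con 1 :+ t) :* (G :* P))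
                                                              refl (G ^ t) t G) ⟩
      (suc t * G ^ suc t) % F         ∎
    fib[m[t+1]+1]≈ : fib (suc (m * suc t)) % F ≡ G ^ suc t % F
    fib[m[t+1]+1]≈ = begin
      fib (suc (m * suc t)) % F            ≡⟨ cong (λ i → fib (suc i) % F) (trans (*-suc m t) (+-comm m (m * t))) ⟩
      fib (suc (m * t + m)) % F            ≡⟨ cong (_% F) (fib-+ (m * t) m) ⟩
      (R * (F + G) + fib (m * t) * F) % F  ≡⟨ cong (_% F) (solve 4 (λ R F G X → R :* (F :+ G) :+ X :* F := R :* G :+ (R :+ X) :* F)
                                                                   refl R F G (fib (m * t))) ⟩
      (R * G + (R + fib (m * t)) * F) % F  ≡⟨ [m+kn]%n≡m%n (R * G) (R + fib (m * t)) F ⟩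
      (R * G) % F                          ≡⟨ %-cong-*ʳ F G fib[mt+1]≈Gᵗ ⟩
      (G ^ t * G) % F                      ≡⟨ cong (_% F) (*-comm (G ^ t) G) ⟩
      G ^ suc t % F                        ∎

  fib-quotient : ∀ t → Σ ℕ (IsFibQuotient t)
  fib-quotient zero = 0 , trans (cong fib (*-zeroʳ (suc m′))) (sym (*-zeroʳ (fib (suc m′)))) , refl ,
                           cong (λ i → fib (suc i) % fib (suc m′)) (*-zeroʳ (suc m′))
  fib-quotient (suc t) = _ , fib-quotient-step t _ (proj₂ (fib-quotient t))

  c*fib∣fib[m*t]⇔∣ : ∀ {c} t → c ∣ fib (suc m′) → c * fib (suc m′) ∣ fib (suc m′ * t) ⇔ c ∣ t
  c*fib∣fib[m*t]⇔∣ {c} t c∣F = mk⇔ c∣t c*F∣fib[mt]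
    where
    F G q : ℕ
    F = fib (suc m′)
    G = fib m′
    q = proj₁ (fib-quotient t)
    fib[mt]≡Fq : fib (suc m′ * t) ≡ F * q
    fib[mt]≡Fq = proj₁ (proj₂ (fib-quotient t))
    qG≈tGᵗ : (q * G) % F ≡ (t * G ^ t) % F
    qG≈tGᵗ = proj₁ (proj₂ (proj₂ (fib-quotient t)))
    coprime[c,G] : Coprime c G
    coprime[c,G] (d∣c , d∣G) = fib-coprime-suc m′ (d∣G , ∣-trans d∣c c∣F)
    c∣t : c * F ∣ fib (suc m′ * t) → c ∣ t
    c∣t c*F∣fib[mt] = coprime-divisor (coprime-^ʳ t coprime[c,G]) (subst (c ∣_) (*-comm t (G ^ t)) c∣tGᵗ)
      where
      c∣q : c ∣ q
      c∣q = *-cancelʳ-∣ F (subst (c * F ∣_) (trans fib[mt]≡Fq (*-comm F q)) c*F∣fib[mt])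
      c∣tGᵗ : c ∣ t * G ^ t
      c∣tGᵗ = ∣-%-transport c∣F qG≈tGᵗ (∣m⇒∣m*n G c∣q)
    c*F∣fib[mt] : c ∣ t → c * F ∣ fib (suc m′ * t)
    c*F∣fib[mt] c∣t = subst (c * F ∣_) (trans (*-comm q F) (sym fib[mt]≡Fq)) (*-monoˡ-∣ F c∣q)
      where
      c∣qG : c ∣ q * G
      c∣qG = ∣-%-transport c∣F (sym qG≈tGᵗ) (∣m⇒∣m*n (G ^ t) c∣t)
      c∣q : c ∣ q
      c∣q = coprime-divisor coprime[c,G] (subst (c ∣_) (*-comm q G) c∣qG)

open FibQuotient using (c*fib∣fib[m*t]⇔∣)

*fib∣fib⇔*∣ : ∀ {c m k} → 3 ≤ m → c ∣ fib m → c * fib m ∣ fib k ⇔ c * m ∣ k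
*fib∣fib⇔*∣ {c} {m@(suc m′)} {k} 3≤m c∣F = mk⇔ c*m∣k c*F∣fib[k]
  where
  c*m∣k : c * fib m ∣ fib k → c * m ∣ k
  c*m∣k c*F∣fib[k] with to (fib∣fib⇔∣ 3≤m) (m*n∣⇒n∣ c (fib m) c*F∣fib[k])
  ... | divides t k≡t*m = subst (c * m ∣_) (sym k≡t*m) (*-monoˡ-∣ m (to (c*fib∣fib[m*t]⇔∣ m′ t c∣F)
                            (subst (λ i → c * fib m ∣ fib i) (trans k≡t*m (*-comm t m)) c*F∣fib[k])))
  c*F∣fib[k] : c * m ∣ k → c * fib m ∣ fib k
  c*F∣fib[k] (divides s k≡s*[c*m]) =
    subst (λ i → c * fib m ∣ fib i) m*[s*c]≡k (from (c*fib∣fib[m*t]⇔∣ m′ (s * c) c∣F) (n∣m*n s))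
    where
    m*[s*c]≡k : m * (s * c) ≡ k
    m*[s*c]≡k = trans (solve 3 (λ m s c → m :* (s :* c) := s :* (c :* m)) refl m s c) (sym k≡s*[c*m])

∣fib-gap : ∀ {x d y δ} → x + d ≡ y → δ ∣ fib x → δ ∣ fib y → δ ∣ fib d
∣fib-gap {x} {d} {δ = δ} x+d≡y δ∣fib[x] δ∣fib[y] =
  ∣fib[m+n]∧∣fib[n]⇒∣fib[m] d x (subst (λ i → δ ∣ fib i) (sym (trans (+-comm d x) x+d≡y)) δ∣fib[y]) δ∣fib[x]

fib-coprime : ∀ x d {y} → x + d ≡ y → fib d ≡ 1 → Coprime (fib x) (fib y)
fib-coprime x d x+d≡y fib[d]≡1 (δ∣fib[x] , δ∣fib[y]) =
  ∣1⇒≡1 (subst (_ ∣_) fib[d]≡1 (∣fib-gap {x} {d} x+d≡y δ∣fib[x] δ∣fib[y]))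

-- Products of Fibonacci numbers

FibPair : ℕ → ℕ → (ℕ → Set) → Set
FibPair x y Extra = ∀ k → fib x * fib y ∣ fib k ⇔ (x ∣ k × y ∣ k × Extra k)

-- fib w * fib z = u * (c * fib z) with u coprime to c * fib z.
fib-block : ∀ {w z c u} → 3 ≤ w → 3 ≤ z → fib w ≡ c * u → Coprime u c → c ∣ fib z →
  (∀ {δ} → δ ∣ fib w → δ ∣ fib z → δ ∣ c) → ∀ k → fib w * fib z ∣ fib k ⇔ (w ∣ k × c * z ∣ k)
fib-block {w} {z} {c} {u} 3≤w 3≤z fib[w]≡cu coprime[u,c] c∣fib[z] common∣c k = mk⇔ conditions product∣fib[k]
  where
  fib[w]*fib[z]≡ : fib w * fib z ≡ u * (c * fib z)
  fib[w]*fib[z]≡ = trans (cong (_* fib z) fib[w]≡cu) (solve 3 (λ c u F → c :* u :* F := u :* (c :* F)) refl c u (fib z))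
  u∣fib[w] : u ∣ fib w
  u∣fib[w] = divides c fib[w]≡cu
  coprime[u,fib[z]] : Coprime u (fib z)
  coprime[u,fib[z]] (e∣u , e∣fib[z]) = coprime[u,c] (e∣u , common∣c (∣-trans e∣u u∣fib[w]) e∣fib[z])
  conditions : fib w * fib z ∣ fib k → w ∣ k × c * z ∣ k
  conditions product∣ =
      to (fib∣fib⇔∣ 3≤w) (∣-trans (m∣m*n (fib z)) product∣)
    , to (*fib∣fib⇔*∣ 3≤z c∣fib[z]) (∣-trans (subst (c * fib z ∣_) (sym fib[w]*fib[z]≡) (n∣m*n u)) product∣)
  product∣fib[k] : w ∣ k × c * z ∣ k → fib w * fib z ∣ fib k
  product∣fib[k] (w∣k , cz∣k) = subst (_∣ fib k) (sym fib[w]*fib[z]≡)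
    (coprime⇒*∣ (coprime-*ʳ coprime[u,c] coprime[u,fib[z]])
      (∣-trans u∣fib[w] (from (fib∣fib⇔∣ 3≤w) w∣k)) (from (*fib∣fib⇔*∣ 3≤z c∣fib[z]) cz∣k))

-- With p = fib d prime (d = 3, 4), the hypotheses on w say that p divides fib w exactly once.
fib-prime-block : ∀ {w z d} → 3 ≤ w → 3 ≤ z → 3 ≤ d → Prime (fib d) → d ∣ w → ¬ fib d * d ∣ w → d ∣ z →
  (∀ {δ} → δ ∣ fib w → δ ∣ fib z → δ ∣ fib d) → ∀ k → fib w * fib z ∣ fib k ⇔ (w ∣ k × fib d * z ∣ k)
fib-prime-block {w} {z} {d} 3≤w 3≤z 3≤d prime[p] d∣w pd∤w d∣z =
  fib-block 3≤w 3≤z fib[w]≡pu (prime∤⇒coprime prime[p] p∤u) (fib-mono-∣ d∣z)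
  where
  p∣fib[w] : fib d ∣ fib w
  p∣fib[w] = fib-mono-∣ d∣w
  u : ℕ
  u = quotient p∣fib[w]
  fib[w]≡pu : fib w ≡ fib d * u
  fib[w]≡pu = m∣n⇒n≡m*quotient p∣fib[w]
  p∤u : ¬ fib d ∣ u
  p∤u p∣u = pd∤w (to (*fib∣fib⇔*∣ 3≤d ∣-refl) (subst (fib d * fib d ∣_) (sym fib[w]≡pu) (*-monoʳ-∣ (fib d) p∣u)))

fib-pair-coprime : ∀ {x y d} → 3 ≤ x → 3 ≤ d → Prime (fib d) → x + d ≡ y → ¬ d ∣ x → FibPair x y (λ _ → ⊤)
fib-pair-coprime {x} {y} {d} 3≤x 3≤d prime[p] x+d≡y d∤x k =
  mk⇔ (λ product∣ → let (x∣k , y∣k) = to conditions product∣ in x∣k , y∣k , tt)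
      (λ (x∣k , y∣k , _) → from conditions (x∣k , y∣k))
  where
  3≤y : 3 ≤ y
  3≤y = subst (3 ≤_) x+d≡y (m≤n⇒m≤n+o d 3≤x)
  coprime[fib[x],fib[y]] : Coprime (fib x) (fib y)
  coprime[fib[x],fib[y]] (δ∣fib[x] , δ∣fib[y]) =
    prime∤⇒coprime prime[p] (λ p∣fib[x] → d∤x (to (fib∣fib⇔∣ 3≤d) p∣fib[x]))
      (δ∣fib[x] , ∣fib-gap {x} {d} x+d≡y δ∣fib[x] δ∣fib[y])
  conditions : fib x * fib y ∣ fib k ⇔ (x ∣ k × y ∣ k)
  conditions = mk⇔ (λ product∣ → let (fib[x]∣ , fib[y]∣) = to (coprime⇒*∣⇔ coprime[fib[x],fib[y]]) product∣
                                  in to (fib∣fib⇔∣ 3≤x) fib[x]∣ , to (fib∣fib⇔∣ 3≤y) fib[y]∣)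
                   (λ (x∣k , y∣k) → coprime⇒*∣ coprime[fib[x],fib[y]] (from (fib∣fib⇔∣ 3≤x) x∣k)
                                                                         (from (fib∣fib⇔∣ 3≤y) y∣k))

fib-pair-block : ∀ {x y d} → 3 ≤ x → 3 ≤ d → Prime (fib d) → x + d ≡ y → d ∣ x → ¬ fib d * d ∣ x →
  FibPair x y (λ k → fib d * y ∣ k)
fib-pair-block {x} {y} {d} 3≤x 3≤d prime[p] x+d≡y d∣x pd∤x k =
  mk⇔ (λ product∣ → let (x∣k , py∣k) = to block product∣ in x∣k , m*n∣⇒n∣ (fib d) y py∣k , py∣k)
      (λ (x∣k , _ , py∣k) → from block (x∣k , py∣k))
  where
  block : fib x * fib y ∣ fib k ⇔ (x ∣ k × fib d * y ∣ k)
  block = fib-prime-block 3≤x (subst (3 ≤_) x+d≡y (m≤n⇒m≤n+o d 3≤x)) 3≤d prime[p] d∣x pd∤x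
            (subst (d ∣_) x+d≡y (∣m∣n⇒∣m+n d∣x ∣-refl)) (∣fib-gap {x} {d} x+d≡y) k

fib-pair-block′ : ∀ {x y d} → 3 ≤ x → 3 ≤ d → Prime (fib d) → x + d ≡ y → d ∣ y → ¬ fib d * d ∣ y →
  FibPair x y (λ k → fib d * x ∣ k)
fib-pair-block′ {x} {y} {d} 3≤x 3≤d prime[p] x+d≡y d∣y pd∤y k =
  mk⇔ (λ product∣ → let (y∣k , px∣k) = to block (subst (_∣ fib k) (*-comm (fib x) (fib y)) product∣)
                    in m*n∣⇒n∣ (fib d) x px∣k , y∣k , px∣k)
      (λ (_ , y∣k , px∣k) → subst (_∣ fib k) (*-comm (fib y) (fib x)) (from block (y∣k , px∣k)))
  where
  d∣x : d ∣ x
  d∣x = ∣m+n∣m⇒∣n (subst (d ∣_) (trans (sym x+d≡y) (+-comm x d)) d∣y) ∣-refl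
  block : fib y * fib x ∣ fib k ⇔ (y ∣ k × fib d * x ∣ k)
  block = fib-prime-block (subst (3 ≤_) x+d≡y (m≤n⇒m≤n+o d 3≤x)) 3≤x 3≤d prime[p] d∣y pd∤y d∣x
            (λ δ∣fib[y] δ∣fib[x] → ∣fib-gap {x} {d} x+d≡y δ∣fib[x] δ∣fib[y]) k

fibProd5∣⇔ : ∀ n {N} → fibProd5 n ∣ N ⇔
  (fib n * fib (n + 3) ∣ N × fib (n + 1) * fib (n + 4) ∣ N × fib n * fib (n + 4) ∣ N × fib (n + 2) ∣ N)
fibProd5∣⇔ n = *∣-five⇔ (fib-coprime n 1 refl refl) (fib-coprime n 2 refl refl)
  (fib-coprime (n + 1) 1 (+-assoc n 1 1) refl) (fib-coprime (n + 1) 2 (+-assoc n 1 2) refl)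
  (fib-coprime (n + 2) 1 (+-assoc n 2 1) refl) (fib-coprime (n + 2) 2 (+-assoc n 2 2) refl)
  (fib-coprime (n + 3) 1 (+-assoc n 3 1) refl)

fibProd5∣fib⇔ : ∀ {n E₀₃ E₁₄ E₀₄} → 3 ≤ n →
  FibPair n (n + 3) E₀₃ → FibPair (n + 1) (n + 4) E₁₄ → FibPair n (n + 4) E₀₄ →
  ∀ k → fibProd5 n ∣ fib k ⇔ (lcm5 n ∣ k × E₀₃ k × E₁₄ k × E₀₄ k)
fibProd5∣fib⇔ {n} {E₀₃} {E₁₄} {E₀₄} 3≤n pair₀₃ pair₁₄ pair₀₄ k =
  ⇔-trans (fibProd5∣⇔ n) (⇔-trans (pair₀₃ k ×-⇔ pair₁₄ k ×-⇔ pair₀₄ k ×-⇔ fib∣fib⇔∣ (m≤n⇒m≤n+o 2 3≤n))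
                                  (mk⇔ collect distribute))
  where
  Pairs : Set
  Pairs = (n ∣ k × n + 3 ∣ k × E₀₃ k) × (n + 1 ∣ k × n + 4 ∣ k × E₁₄ k) × (n ∣ k × n + 4 ∣ k × E₀₄ k)
        × n + 2 ∣ k
  collect : Pairs → lcm5 n ∣ k × E₀₃ k × E₁₄ k × E₀₄ k
  collect ((n∣k , n+3∣k , e₀₃) , (n+1∣k , n+4∣k , e₁₄) , (_ , _ , e₀₄) , n+2∣k) =
    from (lcm5∣⇔ n) (n∣k , n+1∣k , n+2∣k , n+3∣k , n+4∣k) , e₀₃ , e₁₄ , e₀₄
  distribute : lcm5 n ∣ k × E₀₃ k × E₁₄ k × E₀₄ k → Pairs
  distribute (lcm5∣k , e₀₃ , e₁₄ , e₀₄) with to (lcm5∣⇔ n) lcm5∣k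
  ... | n∣k , n+1∣k , n+2∣k , n+3∣k , n+4∣k =
    (n∣k , n+3∣k , e₀₃) , (n+1∣k , n+4∣k , e₁₄) , (n∣k , n+4∣k , e₀₄) , n+2∣k

rank-of-⇔ : ∀ {b e} → e > 0 → (∀ k → b ∣ fib k ⇔ e ∣ k) → IsRankOfApparition b e
rank-of-⇔ {b} {e} e>0 b∣fib⇔e∣ =
  e>0 , from (b∣fib⇔e∣ e) ∣-refl ,
  λ j j>0 j<e b∣fib[j] → <⇒≱ j<e (∣⇒≤ {{>-nonZero j>0}} (to (b∣fib⇔e∣ j) b∣fib[j]))

-- Valuations

-- The p-adic valuation of x is at most that of y. Below, d ∣ x and ¬ d * p ∣ x express that
-- x and d have the same p-adic valuation.
record Dominated (p x y : ℕ) : Set where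
  constructor dominated
  field
    cofactor      : ℕ
    x∣y*cofactor  : x ∣ y * cofactor
    p∤cofactor    : ¬ p ∣ cofactor

dominated-refl : ∀ {p y} → Prime p → Dominated p y y
dominated-refl {y = y} prime[p] =
  dominated 1 (∣-reflexive (sym (*-identityʳ y))) λ p∣1 → ¬prime[1] (subst Prime (∣1⇒≡1 p∣1) prime[p])

dominated-∤ : ∀ {p x y} → ¬ p ∣ x → Dominated p x y
dominated-∤ {x = x} {y} p∤x = dominated x (n∣m*n y) p∤x

dominated-∣ : ∀ {p d x y} → d ∣ x → ¬ d * p ∣ x → d ∣ y → Dominated p x y
dominated-∣ {p} {d} (divides u refl) dp∤ud (divides v refl) =
  dominated u (divides v (solve 3 (λ v d u → v :* d :* u := v :* (u :* d)) refl v d u))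
  λ p∣u → dp∤ud (subst (d * p ∣_) (*-comm d u) (*-monoʳ-∣ d p∣u))

dominated-lcm : ∀ {p a b y} → Prime p → Dominated p a y → Dominated p b y → Dominated p (lcm a b) y
dominated-lcm {y = y} prime[p] (dominated c₁ a∣yc₁ p∤c₁) (dominated c₂ b∣yc₂ p∤c₂) =
  dominated (c₁ * c₂)
  (lcm-least (∣-trans a∣yc₁ (divides c₂ (solve 3 (λ y c₁ c₂ → y :* (c₁ :* c₂) := c₂ :* (y :* c₁)) refl y c₁ c₂)))
            (∣-trans b∣yc₂ (divides c₁ (solve 3 (λ y c₁ c₂ → y :* (c₁ :* c₂) := c₁ :* (y :* c₂)) refl y c₁ c₂))))
  λ p∣c₁c₂ → [ p∤c₁ , p∤c₂ ]′ (euclidsLemma c₁ c₂ prime[p] p∣c₁c₂)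

dominated-lcm5 : ∀ {p n y} → Prime p → Dominated p n y → Dominated p (n + 1) y → Dominated p (n + 2) y →
  Dominated p (n + 3) y → Dominated p (n + 4) y → Dominated p (lcm5 n) y
dominated-lcm5 prime[p] d₀ d₁ d₂ d₃ d₄ =
  dominated-lcm prime[p] d₀ (dominated-lcm prime[p] d₁ (dominated-lcm prime[p] d₂ (dominated-lcm prime[p] d₃ d₄)))

*∣-lift : ∀ {p d y L} → Prime p → .{{_ : NonZero d}} → d ∣ y → ¬ d * p ∣ y → d * p ∣ L → y ∣ L → p * y ∣ L
*∣-lift {p} {d} {y} prime[p] (divides u refl) dp∤ud dp∣L (divides m refl) =
  *-monoˡ-∣ y (prime∣*∧∤⇒∣ {m = m} prime[p] p∣mu p∤u)
  where
  p∣mu : p ∣ m * u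
  p∣mu = *-cancelˡ-∣ d (subst (d * p ∣_) (solve 3 (λ m u d → m :* (u :* d) := d :* (m :* u)) refl m u d) dp∣L)
  p∤u : ¬ p ∣ u
  p∤u p∣u = dp∤ud (subst (d * p ∣_) (*-comm d u) (*-monoʳ-∣ d p∣u))

∣∧∣⇔1*∣ : ∀ {z L k} → z ∣ L → (L ∣ k × z ∣ k) ⇔ 1 * L ∣ k
∣∧∣⇔1*∣ {z} {L} {k} z∣L =
  subst (λ e → (L ∣ k × z ∣ k) ⇔ e ∣ k) (sym (*-identityˡ L)) (implied⇒×⇔ (∣-trans z∣L))

∣∧p*∣⇔p*∣ : ∀ {p y L k} → Prime p → .{{_ : NonZero y}} → y ∣ L → Dominated p L y →
  (L ∣ k × p * y ∣ k) ⇔ p * L ∣ k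
∣∧p*∣⇔p*∣ {p} {y} {L} prime[p] y∣L (dominated c L∣yc p∤c) = mk⇔ pL∣k conditions
  where
  pL∣k : ∀ {k} → L ∣ k × p * y ∣ k → p * L ∣ k
  pL∣k (divides t refl , py∣tL) = *-monoˡ-∣ L (prime∣*∧∤⇒∣ {m = t} prime[p] p∣tc p∤c)
    where
    p∣tc : p ∣ t * c
    p∣tc = *-cancelˡ-∣ y (subst₂ _∣_ (*-comm p y) (solve 3 (λ t y c → t :* (y :* c) := y :* (t :* c)) refl t y c)
                                   (∣-trans py∣tL (*-monoʳ-∣ t L∣yc)))
  conditions : ∀ {k} → p * L ∣ k → L ∣ k × p * y ∣ k
  conditions pL∣k = ∣-trans (n∣m*n p) pL∣k , ∣-trans (*-monoʳ-∣ p y∣L) pL∣k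

72*L/[g₈*g₉]≡ : ∀ L {g₈ g₉ s₂ s₃} .{{_ : NonZero (g₈ * g₉)}} → g₈ * s₂ ≡ 8 → g₉ * s₃ ≡ 9 →
  72 * L / (g₈ * g₉) ≡ s₂ * s₃ * L
72*L/[g₈*g₉]≡ L {g₈} {g₉} {s₂} {s₃} g₈s₂≡8 g₉s₃≡9 = trans (/-congˡ 72L≡) (m*n/n≡m (s₂ * s₃ * L) (g₈ * g₉))
  where
  open ≡-Reasoning
  72L≡ : 72 * L ≡ s₂ * s₃ * L * (g₈ * g₉)
  72L≡ = begin
    72 * L                       ≡⟨ cong₂ (λ x y → x * y * L) g₈s₂≡8 g₉s₃≡9 ⟨
    g₈ * s₂ * (g₉ * s₃) * L      ≡⟨ solve 5 (λ a s b t L → a :* s :* (b :* t) :* L := s :* t :* L :* (a :* b))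
                                           refl g₈ s₂ g₉ s₃ L ⟩
    s₂ * s₃ * L * (g₈ * g₉)      ∎

divGcds≡ : ∀ L {P Q s₂ s₃} → gcd 8 P * s₂ ≡ 8 → gcd 9 Q * s₃ ≡ 9 → divGcds (72 * L) P Q ≡ s₂ * s₃ * L
divGcds≡ L {P} {Q} {s₂} {s₃} =
  72*L/[g₈*g₉]≡ L {gcd 8 P} {gcd 9 Q} {s₂} {s₃} {{m*n≢0 (gcd 8 P) (gcd 9 Q) {{gcd-suc-nonZero 7 P}} {{gcd-suc-nonZero 8 Q}}}}

ExtraFactor : ℕ → ℕ → ℕ → ℕ → Set
ExtraFactor g P L a = Σ ℕ λ s → gcd g P * s ≡ g × (∀ k → (L ∣ k × a ∣ k) ⇔ s * L ∣ k)

∣divGcds⇔ : ∀ P Q {L a b} → ExtraFactor 8 P L a → ExtraFactor 9 Q L b →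
  ∀ k → (L ∣ k × a ∣ k × b ∣ k) ⇔ divGcds (72 * L) P Q ∣ k
∣divGcds⇔ P Q {L} {a} {b} (s₂ , g₈s₂≡8 , two-part) (s₃ , g₉s₃≡9 , three-part) k =
  subst (λ e → (L ∣ k × a ∣ k × b ∣ k) ⇔ e ∣ k) (sym (divGcds≡ L {P} {Q} {s₂} {s₃} g₈s₂≡8 g₉s₃≡9))
        (mk⇔ s₂s₃L∣k conditions)
  where
  coprime[s₂,s₃] : Coprime s₂ s₃
  coprime[s₂,s₃] (δ∣s₂ , δ∣s₃) =
    ∣1⇒≡1 (∣m+n∣m⇒∣n {m = 8} (∣-trans δ∣s₃ (divides (gcd 9 Q) (sym g₉s₃≡9)))
                                (∣-trans δ∣s₂ (divides (gcd 8 P) (sym g₈s₂≡8))))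
  s₂s₃L∣k : L ∣ k × a ∣ k × b ∣ k → s₂ * s₃ * L ∣ k
  s₂s₃L∣k (L∣k , a∣k , b∣k) = subst (_∣ k) (solve 3 (λ L s t → L :* s :* t := s :* t :* L) refl L s₂ s₃)
    (*∣∧*∣⇒**∣ {L} coprime[s₂,s₃] (subst (_∣ k) (*-comm s₂ L) (to (two-part k) (L∣k , a∣k)))
                                  (subst (_∣ k) (*-comm s₃ L) (to (three-part k) (L∣k , b∣k))))
  conditions : s₂ * s₃ * L ∣ k → L ∣ k × a ∣ k × b ∣ k
  conditions s₂s₃L∣k =
    let (L∣k , a∣k) = from (two-part k) (∣-trans s₂L∣s₂s₃L s₂s₃L∣k)
    in L∣k , a∣k , proj₂ (from (three-part k) (∣-trans s₃L∣s₂s₃L s₂s₃L∣k))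
    where
    s₂L∣s₂s₃L : s₂ * L ∣ s₂ * s₃ * L
    s₂L∣s₂s₃L = divides s₃ (solve 3 (λ s t L → s :* t :* L := t :* (s :* L)) refl s₂ s₃ L)
    s₃L∣s₂s₃L : s₃ * L ∣ s₂ * s₃ * L
    s₃L∣s₂s₃L = divides s₂ (solve 3 (λ s t L → s :* t :* L := s :* (t :* L)) refl s₂ s₃ L)

divGcds>0 : ∀ {L} P Q → L > 0 → divGcds (72 * L) P Q > 0
divGcds>0 {L} P Q L>0 = m≥n⇒m/n>0 {{m*n≢0 (gcd 8 P) (gcd 9 Q) {{gcd-suc-nonZero 7 P}} {{gcd-suc-nonZero 8 Q}}}}
  (≤-trans (*-mono-≤ (∣⇒≤ (gcd[m,n]∣m 8 P)) (∣⇒≤ (gcd[m,n]∣m 9 Q))) (m≤m*n 72 L {{>-nonZero L>0}}))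

-- The residue classes of n

3≤4 : 3 ≤ 4
3≤4 = n≤1+n 3

rank-n≡1 : ∀ k → fibProd5 1 ∣ fib k ⇔ lcm5 1 ∣ k
rank-n≡1 k = ⇔-trans (fibProd5∣⇔ 1) (mk⇔ lcm5∣k conditions)
  where
  lcm5∣k : 3 ∣ fib k × 5 ∣ fib k × 5 ∣ fib k × 2 ∣ fib k → lcm5 1 ∣ k
  lcm5∣k (3∣fib[k] , 5∣fib[k] , _ , 2∣fib[k]) =
    let 4∣k = to (fib∣fib⇔∣ {4} 3≤4) 3∣fib[k]
    in from (lcm5∣⇔ 1) (1∣ k , ∣-trans (divides 2 refl) 4∣k , to (fib∣fib⇔∣ {3} ≤-refl) 2∣fib[k] , 4∣k ,
                        to (fib∣fib⇔∣ {5} (m≤n⇒m≤n+o 2 ≤-refl)) 5∣fib[k])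
  conditions : lcm5 1 ∣ k → 3 ∣ fib k × 5 ∣ fib k × 5 ∣ fib k × 2 ∣ fib k
  conditions lcm5∣k =
    let (_ , _ , 3∣k , 4∣k , 5∣k) = to (lcm5∣⇔ 1) lcm5∣k
        5∣fib[k] = from (fib∣fib⇔∣ {5} (m≤n⇒m≤n+o 2 ≤-refl)) 5∣k
    in from (fib∣fib⇔∣ {4} 3≤4) 4∣k , 5∣fib[k] , 5∣fib[k] , from (fib∣fib⇔∣ {3} ≤-refl) 3∣k

rank-n≡2 : ∀ k → fibProd5 2 ∣ fib k ⇔ lcm5 2 ∣ k
rank-n≡2 k = ⇔-trans (fibProd5∣⇔ 2) (mk⇔ lcm5∣k conditions)
  where
  pair₃₆ : FibPair 3 6 (λ k → 2 * 6 ∣ k)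
  pair₃₆ = fib-pair-block ≤-refl ≤-refl prime[2] refl ∣-refl (from-no (6 ∣? 3))
  lcm5∣k : 5 ∣ fib k × 16 ∣ fib k × 8 ∣ fib k × 3 ∣ fib k → lcm5 2 ∣ k
  lcm5∣k (5∣fib[k] , 16∣fib[k] , _ , 3∣fib[k]) =
    let (3∣k , 6∣k , _) = to (pair₃₆ k) 16∣fib[k]
        4∣k = to (fib∣fib⇔∣ {4} 3≤4) 3∣fib[k]
    in from (lcm5∣⇔ 2) (∣-trans (divides 2 refl) 4∣k , 3∣k , 4∣k ,
                        to (fib∣fib⇔∣ {5} (m≤n⇒m≤n+o 2 ≤-refl)) 5∣fib[k] , 6∣k)
  conditions : lcm5 2 ∣ k → 5 ∣ fib k × 16 ∣ fib k × 8 ∣ fib k × 3 ∣ fib k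
  conditions lcm5∣k =
    let (_ , 3∣k , 4∣k , 5∣k , 6∣k) = to (lcm5∣⇔ 2) lcm5∣k
    in from (fib∣fib⇔∣ {5} (m≤n⇒m≤n+o 2 ≤-refl)) 5∣k ,
       from (pair₃₆ k) (3∣k , 6∣k , coprime⇒*∣ (from-yes (coprime? 3 4)) 3∣k 4∣k) ,
       from (fib∣fib⇔∣ {6} (m≤n⇒m≤n+o 3 ≤-refl)) 6∣k , from (fib∣fib⇔∣ {4} 3≤4) 4∣k

rank-small : ∀ {n} → n < 3 → 1 ≤ n → ∀ k → fibProd5 n ∣ fib k ⇔ lcm5 n ∣ k
rank-small {1} _ _ = rank-n≡1
rank-small {2} _ _ = rank-n≡2
rank-small {suc (suc (suc _))} (s≤s (s≤s (s≤s ()))) _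

rank-≡1[3] : ∀ {n} → 3 ≤ n → n % 3 ≡ 1 → ∀ k → fibProd5 n ∣ fib k ⇔ lcm5 n ∣ k
rank-≡1[3] {n} 3≤n h k = by-4∣n (4 ∣? n)
  where
  open Lcm5Divisors n
  open Residue n 3 _ h
  pair₀₃ : FibPair n (n + 3) (λ _ → ⊤)
  pair₀₃ = fib-pair-coprime 3≤n ≤-refl prime[2] refl (∤n 3 refl refl)
  pair₁₄ : FibPair (n + 1) (n + 4) (λ _ → ⊤)
  pair₁₄ = fib-pair-coprime (m≤n⇒m≤n+o 1 3≤n) ≤-refl prime[2] (+-assoc n 1 3) (∤n+ 1 3 refl refl)
  by-4∣n : Dec (4 ∣ n) → fibProd5 n ∣ fib k ⇔ lcm5 n ∣ k
  by-4∣n (yes 4∣n) = ⇔-trans (fibProd5∣fib⇔ 3≤n pair₀₃ pair₁₄ pair₀₄ k)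
                             (implied⇒×⇔ (λ L∣k → tt , tt , ∣-trans 3[n+4]∣L L∣k))
    where
    12∤n : ¬ 12 ∣ n
    12∤n 12∣n = ∤n 3 refl refl (∣-trans (divides 4 refl) 12∣n)
    pair₀₄ : FibPair n (n + 4) (λ k → 3 * (n + 4) ∣ k)
    pair₀₄ = fib-pair-block 3≤n 3≤4 prime[3] refl 4∣n 12∤n
    3[n+4]∣L : 3 * (n + 4) ∣ lcm5 n
    3[n+4]∣L = *∣-lift {d = 1} prime[3] (1∣ _) (∤n+ 4 3 refl refl) (∣-trans (∣n+ 2 3 refl refl) n+2∣lcm5) n+4∣lcm5
  by-4∣n (no 4∤n) = ⇔-trans (fibProd5∣fib⇔ 3≤n pair₀₃ pair₁₄ (fib-pair-coprime 3≤n 3≤4 prime[3] refl 4∤n) k)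
                             (implied⇒×⇔ (λ _ → tt , tt , tt))

rank-≡2[12] : ∀ {n} → 3 ≤ n → n % 12 ≡ 2 → ∀ k → fibProd5 n ∣ fib k ⇔ lcm5 n ∣ k
rank-≡2[12] {n} 3≤n h k =
  ⇔-trans (fibProd5∣fib⇔ 3≤n pair₀₃ pair₁₄ pair₀₄ k) (implied⇒×⇔ (λ L∣k → tt , ∣-trans 2[n+4]∣L L∣k , tt))
  where
  open Lcm5Divisors n
  open Residue n 12 _ h
  pair₀₃ : FibPair n (n + 3) (λ _ → ⊤)
  pair₀₃ = fib-pair-coprime 3≤n ≤-refl prime[2] refl (∤n 3 refl refl)
  pair₁₄ : FibPair (n + 1) (n + 4) (λ k → 2 * (n + 4) ∣ k)
  pair₁₄ = fib-pair-block (m≤n⇒m≤n+o 1 3≤n) ≤-refl prime[2] (+-assoc n 1 3) (∣n+ 1 3 refl refl) (∤n+ 1 6 refl refl)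
  pair₀₄ : FibPair n (n + 4) (λ _ → ⊤)
  pair₀₄ = fib-pair-coprime 3≤n 3≤4 prime[3] refl (∤n 4 refl refl)
  2[n+4]∣L : 2 * (n + 4) ∣ lcm5 n
  2[n+4]∣L = *∣-lift {d = 2} prime[2] (∣n+ 4 2 refl refl) (∤n+ 4 4 refl refl)
               (∣-trans (∣n+ 2 4 refl refl) n+2∣lcm5) n+4∣lcm5

rank-≡3[12] : ∀ {n} → n % 12 ≡ 3 → ∀ k → fibProd5 n ∣ fib k ⇔ lcm5 n ∣ k
rank-≡3[12] {n} h k =
  ⇔-trans (fibProd5∣fib⇔ 3≤n pair₀₃ pair₁₄ pair₀₄ k) (implied⇒×⇔ (λ L∣k → ∣-trans 2[n+3]∣L L∣k , tt , tt))
  where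
  open Lcm5Divisors n
  open Residue n 12 _ h
  3≤n : 3 ≤ n
  3≤n = residue≥3 12 h
  pair₀₃ : FibPair n (n + 3) (λ k → 2 * (n + 3) ∣ k)
  pair₀₃ = fib-pair-block 3≤n ≤-refl prime[2] refl (∣n 3 refl refl) (∤n 6 refl refl)
  pair₁₄ : FibPair (n + 1) (n + 4) (λ _ → ⊤)
  pair₁₄ = fib-pair-coprime (m≤n⇒m≤n+o 1 3≤n) ≤-refl prime[2] (+-assoc n 1 3) (∤n+ 1 3 refl refl)
  pair₀₄ : FibPair n (n + 4) (λ _ → ⊤)
  pair₀₄ = fib-pair-coprime 3≤n 3≤4 prime[3] refl (∤n 4 refl refl)
  2[n+3]∣L : 2 * (n + 3) ∣ lcm5 n
  2[n+3]∣L = *∣-lift {d = 2} prime[2] (∣n+ 3 2 refl refl) (∤n+ 3 4 refl refl)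
               (∣-trans (∣n+ 1 4 refl refl) n+1∣lcm5) n+3∣lcm5

rank-≡5[12] : ∀ {n} → n % 12 ≡ 5 → ∀ k → fibProd5 n ∣ fib k ⇔ lcm5 n ∣ k
rank-≡5[12] {n} h k =
  ⇔-trans (fibProd5∣fib⇔ 3≤n pair₀₃ pair₁₄ pair₀₄ k) (implied⇒×⇔ (λ L∣k → tt , ∣-trans 2[n+1]∣L L∣k , tt))
  where
  open Lcm5Divisors n
  open Residue n 12 _ h
  3≤n : 3 ≤ n
  3≤n = residue≥3 12 h
  pair₀₃ : FibPair n (n + 3) (λ _ → ⊤)
  pair₀₃ = fib-pair-coprime 3≤n ≤-refl prime[2] refl (∤n 3 refl refl)
  pair₁₄ : FibPair (n + 1) (n + 4) (λ k → 2 * (n + 1) ∣ k)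
  pair₁₄ = fib-pair-block′ (m≤n⇒m≤n+o 1 3≤n) ≤-refl prime[2] (+-assoc n 1 3) (∣n+ 4 3 refl refl) (∤n+ 4 6 refl refl)
  pair₀₄ : FibPair n (n + 4) (λ _ → ⊤)
  pair₀₄ = fib-pair-coprime 3≤n 3≤4 prime[3] refl (∤n 4 refl refl)
  2[n+1]∣L : 2 * (n + 1) ∣ lcm5 n
  2[n+1]∣L = *∣-lift {d = 2} prime[2] (∣n+ 1 2 refl refl) (∤n+ 1 4 refl refl)
               (∣-trans (∣n+ 3 4 refl refl) n+3∣lcm5) n+1∣lcm5

rank-≡6[12] : ∀ {n} → n % 12 ≡ 6 → ∀ k → fibProd5 n ∣ fib k ⇔ lcm5 n ∣ k
rank-≡6[12] {n} h k =
  ⇔-trans (fibProd5∣fib⇔ 3≤n pair₀₃ pair₁₄ pair₀₄ k) (implied⇒×⇔ (λ L∣k → ∣-trans 2n∣L L∣k , tt , tt))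
  where
  open Lcm5Divisors n
  open Residue n 12 _ h
  3≤n : 3 ≤ n
  3≤n = residue≥3 12 h
  pair₀₃ : FibPair n (n + 3) (λ k → 2 * n ∣ k)
  pair₀₃ = fib-pair-block′ 3≤n ≤-refl prime[2] refl (∣n+ 3 3 refl refl) (∤n+ 3 6 refl refl)
  pair₁₄ : FibPair (n + 1) (n + 4) (λ _ → ⊤)
  pair₁₄ = fib-pair-coprime (m≤n⇒m≤n+o 1 3≤n) ≤-refl prime[2] (+-assoc n 1 3) (∤n+ 1 3 refl refl)
  pair₀₄ : FibPair n (n + 4) (λ _ → ⊤)
  pair₀₄ = fib-pair-coprime 3≤n 3≤4 prime[3] refl (∤n 4 refl refl)
  2n∣L : 2 * n ∣ lcm5 n
  2n∣L = *∣-lift {d = 2} prime[2] (∣n 2 refl refl) (∤n 4 refl refl)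
           (∣-trans (∣n+ 2 4 refl refl) n+2∣lcm5) n∣lcm5

rank-lcm5 : ∀ {n} → 1 ≤ n → (n % 3 ≡ 1 ⊎ n % 12 ≡ 2 ⊎ n % 12 ≡ 3 ⊎ n % 12 ≡ 5 ⊎ n % 12 ≡ 6) →
  ∀ k → fibProd5 n ∣ fib k ⇔ lcm5 n ∣ k
rank-lcm5 {n} 1≤n residue with 3 ≤? n
... | no 3≰n  = rank-small (≰⇒> 3≰n) 1≤n
... | yes 3≤n =
  [ rank-≡1[3] 3≤n , [ rank-≡2[12] 3≤n , [ rank-≡3[12] {n} , [ rank-≡5[12] {n} , rank-≡6[12] {n} ]′ ]′ ]′ ]′ residue

rank-≡9[12] : ∀ {n} → n % 12 ≡ 9 → ∀ k → fibProd5 n ∣ fib k ⇔ 2 * lcm5 n ∣ k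
rank-≡9[12] {n} h k = ⇔-trans (fibProd5∣fib⇔ 3≤n pair₀₃ pair₁₄ pair₀₄ k)
  (⇔-trans (mk⇔ (λ (L∣k , e₀₃ , _) → L∣k , e₀₃) (λ (L∣k , e₀₃) → L∣k , e₀₃ , tt , tt))
           (∣∧p*∣⇔p*∣ prime[2] {{≢-nonZero (m+1+n≢0 n)}} n+3∣lcm5 lcm5-dominated))
  where
  open Lcm5Divisors n
  open Residue n 12 _ h
  3≤n : 3 ≤ n
  3≤n = residue≥3 12 h
  pair₀₃ : FibPair n (n + 3) (λ k → 2 * (n + 3) ∣ k)
  pair₀₃ = fib-pair-block 3≤n ≤-refl prime[2] refl (∣n 3 refl refl) (∤n 6 refl refl)
  pair₁₄ : FibPair (n + 1) (n + 4) (λ _ → ⊤)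
  pair₁₄ = fib-pair-coprime (m≤n⇒m≤n+o 1 3≤n) ≤-refl prime[2] (+-assoc n 1 3) (∤n+ 1 3 refl refl)
  pair₀₄ : FibPair n (n + 4) (λ _ → ⊤)
  pair₀₄ = fib-pair-coprime 3≤n 3≤4 prime[3] refl (∤n 4 refl refl)
  lcm5-dominated : Dominated 2 (lcm5 n) (n + 3)
  lcm5-dominated = dominated-lcm5 prime[2]
    (dominated-∤ (∤n 2 refl refl))
    (dominated-∣ {d = 2} (∣n+ 1 2 refl refl) (∤n+ 1 4 refl refl) (∣n+ 3 2 refl refl))
    (dominated-∤ (∤n+ 2 2 refl refl))
    (dominated-refl prime[2])
    (dominated-∤ (∤n+ 4 2 refl refl))

rank-≡11[12] : ∀ {n} → n % 12 ≡ 11 → ∀ k → fibProd5 n ∣ fib k ⇔ 2 * lcm5 n ∣ k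
rank-≡11[12] {n} h k = ⇔-trans (fibProd5∣fib⇔ 3≤n pair₀₃ pair₁₄ pair₀₄ k)
  (⇔-trans (mk⇔ (λ (L∣k , _ , e₁₄ , _) → L∣k , e₁₄) (λ (L∣k , e₁₄) → L∣k , tt , e₁₄ , tt))
           (∣∧p*∣⇔p*∣ prime[2] {{≢-nonZero (m+1+n≢0 n)}} n+1∣lcm5 lcm5-dominated))
  where
  open Lcm5Divisors n
  open Residue n 12 _ h
  3≤n : 3 ≤ n
  3≤n = residue≥3 12 h
  pair₀₃ : FibPair n (n + 3) (λ _ → ⊤)
  pair₀₃ = fib-pair-coprime 3≤n ≤-refl prime[2] refl (∤n 3 refl refl)
  pair₁₄ : FibPair (n + 1) (n + 4) (λ k → 2 * (n + 1) ∣ k)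
  pair₁₄ = fib-pair-block′ (m≤n⇒m≤n+o 1 3≤n) ≤-refl prime[2] (+-assoc n 1 3) (∣n+ 4 3 refl refl) (∤n+ 4 6 refl refl)
  pair₀₄ : FibPair n (n + 4) (λ _ → ⊤)
  pair₀₄ = fib-pair-coprime 3≤n 3≤4 prime[3] refl (∤n 4 refl refl)
  lcm5-dominated : Dominated 2 (lcm5 n) (n + 1)
  lcm5-dominated = dominated-lcm5 prime[2]
    (dominated-∤ (∤n 2 refl refl))
    (dominated-refl prime[2])
    (dominated-∤ (∤n+ 2 2 refl refl))
    (dominated-∣ {d = 2} (∣n+ 3 2 refl refl) (∤n+ 3 4 refl refl) (∣n+ 1 2 refl refl))
    (dominated-∤ (∤n+ 4 2 refl refl))

module Case≡8[12] (n : ℕ) (h : n % 12 ≡ 8) where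
  private instance
    n+4≢0 : NonZero (n + 4)
    n+4≢0 = ≢-nonZero (m+1+n≢0 n)
  open Lcm5Divisors n

  3≤n : 3 ≤ n
  3≤n = residue≥3 12 h

  lcm5∣∧3[n+4]∣⇔3*lcm5∣ : ¬ 9 ∣ n + 1 → ∀ k → (lcm5 n ∣ k × 3 * (n + 4) ∣ k) ⇔ 3 * lcm5 n ∣ k
  lcm5∣∧3[n+4]∣⇔3*lcm5∣ 9∤n+1 k = ∣∧p*∣⇔p*∣ prime[3] n+4∣lcm5 (dominated-lcm5 prime[3]
    (dominated-∤ (∤n 3 refl refl))
    (dominated-∣ {d = 3} (∣n+ 1 3 refl refl) 9∤n+1 (∣n+ 4 3 refl refl))
    (dominated-∤ (∤n+ 2 3 refl refl))
    (dominated-∤ (∤n+ 3 3 refl refl))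
    (dominated-refl prime[3]))
    where open Residue n 12 _ h

  two-part : ExtraFactor 8 n (lcm5 n) (2 * (n + 4))
  two-part with %-refine n 12 2 h
  ... | 0 , _ , h₂₄ = 1 , cong (_* 1) (gcd-n 8 refl) , λ k → ∣∧∣⇔1*∣
        (*∣-lift {d = 4} prime[2] (∣n+ 4 4 refl refl) (∤n+ 4 8 refl refl) (∣-trans (∣n 8 refl refl) n∣lcm5) n+4∣lcm5)
    where open Residue n 24 _ h₂₄
  ... | 1 , _ , h₂₄ = 2 , cong (_* 2) (gcd-n 8 refl) , λ k → ∣∧p*∣⇔p*∣ prime[2] n+4∣lcm5 (dominated-lcm5 prime[2]
        (dominated-∣ {d = 4} (∣n 4 refl refl) (∤n 8 refl refl) (∣n+ 4 4 refl refl))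
        (dominated-∤ (∤n+ 1 2 refl refl))
        (dominated-∣ {d = 2} (∣n+ 2 2 refl refl) (∤n+ 2 4 refl refl) (∣n+ 4 2 refl refl))
        (dominated-∤ (∤n+ 3 2 refl refl))
        (dominated-refl prime[2]))
    where open Residue n 24 _ h₂₄
  ... | suc (suc _) , s≤s (s≤s ()) , _

  three-part : ExtraFactor 9 (n + 1) (lcm5 n) (3 * (n + 4))
  three-part with %-refine n 12 3 h
  ... | 0 , _ , h₃₆ = 1 , cong (_* 1) (gcd-n+ 1 9 refl) , λ k → ∣∧∣⇔1*∣
        (*∣-lift {d = 3} prime[3] (∣n+ 4 3 refl refl) (∤n+ 4 9 refl refl) (∣-trans (∣n+ 1 9 refl refl) n+1∣lcm5) n+4∣lcm5)
    where open Residue n 36 _ h₃₆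
  ... | 1 , _ , h₃₆ = 3 , cong (_* 3) (gcd-n+ 1 9 refl) , lcm5∣∧3[n+4]∣⇔3*lcm5∣ (∤n+ 1 9 refl refl)
    where open Residue n 36 _ h₃₆
  ... | 2 , _ , h₃₆ = 3 , cong (_* 3) (gcd-n+ 1 9 refl) , lcm5∣∧3[n+4]∣⇔3*lcm5∣ (∤n+ 1 9 refl refl)
    where open Residue n 36 _ h₃₆
  ... | suc (suc (suc _)) , s≤s (s≤s (s≤s ())) , _

  rank : ∀ k → fibProd5 n ∣ fib k ⇔ divGcds (72 * lcm5 n) n (n + 1) ∣ k
  rank k = ⇔-trans (fibProd5∣fib⇔ 3≤n pair₀₃ pair₁₄ pair₀₄ k)
    (⇔-trans (mk⇔ (λ (L∣k , _ , e₁₄ , e₀₄) → L∣k , e₁₄ , e₀₄)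
                  (λ (L∣k , e₁₄ , e₀₄) → L∣k , tt , e₁₄ , e₀₄))
             (∣divGcds⇔ n (n + 1) two-part three-part k))
    where
    open Residue n 12 _ h
    pair₀₃ : FibPair n (n + 3) (λ _ → ⊤)
    pair₀₃ = fib-pair-coprime 3≤n ≤-refl prime[2] refl (∤n 3 refl refl)
    pair₁₄ : FibPair (n + 1) (n + 4) (λ k → 2 * (n + 4) ∣ k)
    pair₁₄ = fib-pair-block (m≤n⇒m≤n+o 1 3≤n) ≤-refl prime[2] (+-assoc n 1 3) (∣n+ 1 3 refl refl) (∤n+ 1 6 refl refl)
    pair₀₄ : FibPair n (n + 4) (λ k → 3 * (n + 4) ∣ k)
    pair₀₄ = fib-pair-block 3≤n 3≤4 prime[3] refl (∣n 4 refl refl) (∤n 12 refl refl)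

module Case≡0[12] (n : ℕ) (1≤n : 1 ≤ n) (h : n % 12 ≡ 0) where
  private instance
    n≢0 : NonZero n
    n≢0 = >-nonZero 1≤n
  open Lcm5Divisors n

  3≤n : 3 ≤ n
  3≤n = ≤-trans (m≤m+n 3 9) (∣⇒≤ (Residue.∣n n 12 _ h 12 refl refl))

  lcm5∣∧3n∣⇔3*lcm5∣ : ¬ 9 ∣ n + 3 → ∀ k → (lcm5 n ∣ k × 3 * n ∣ k) ⇔ 3 * lcm5 n ∣ k
  lcm5∣∧3n∣⇔3*lcm5∣ 9∤n+3 k = ∣∧p*∣⇔p*∣ prime[3] n∣lcm5 (dominated-lcm5 prime[3]
    (dominated-refl prime[3])
    (dominated-∤ (∤n+ 1 3 refl refl))
    (dominated-∤ (∤n+ 2 3 refl refl))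
    (dominated-∣ {d = 3} (∣n+ 3 3 refl refl) 9∤n+3 (∣n 3 refl refl))
    (dominated-∤ (∤n+ 4 3 refl refl)))
    where open Residue n 12 _ h

  two-part : ExtraFactor 8 (n + 4) (lcm5 n) (2 * n)
  two-part with %-refine n 12 2 h
  ... | 0 , _ , h₂₄ = 2 , cong (_* 2) (gcd-n+ 4 8 refl) , λ k → ∣∧p*∣⇔p*∣ prime[2] n∣lcm5 (dominated-lcm5 prime[2]
        (dominated-refl prime[2])
        (dominated-∤ (∤n+ 1 2 refl refl))
        (dominated-∣ {d = 2} (∣n+ 2 2 refl refl) (∤n+ 2 4 refl refl) (∣n 2 refl refl))
        (dominated-∤ (∤n+ 3 2 refl refl))
        (dominated-∣ {d = 4} (∣n+ 4 4 refl refl) (∤n+ 4 8 refl refl) (∣n 4 refl refl)))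
    where open Residue n 24 _ h₂₄
  ... | 1 , _ , h₂₄ = 1 , cong (_* 1) (gcd-n+ 4 8 refl) , λ k → ∣∧∣⇔1*∣
        (*∣-lift {d = 4} prime[2] (∣n 4 refl refl) (∤n 8 refl refl) (∣-trans (∣n+ 4 8 refl refl) n+4∣lcm5) n∣lcm5)
    where open Residue n 24 _ h₂₄
  ... | suc (suc _) , s≤s (s≤s ()) , _

  three-part : ExtraFactor 9 (n + 3) (lcm5 n) (3 * n)
  three-part with %-refine n 12 3 h
  ... | 0 , _ , h₃₆ = 3 , cong (_* 3) (gcd-n+ 3 9 refl) , lcm5∣∧3n∣⇔3*lcm5∣ (∤n+ 3 9 refl refl)
    where open Residue n 36 _ h₃₆
  ... | 1 , _ , h₃₆ = 3 , cong (_* 3) (gcd-n+ 3 9 refl) , lcm5∣∧3n∣⇔3*lcm5∣ (∤n+ 3 9 refl refl)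
    where open Residue n 36 _ h₃₆
  ... | 2 , _ , h₃₆ = 1 , cong (_* 1) (gcd-n+ 3 9 refl) , λ k → ∣∧∣⇔1*∣
        (*∣-lift {d = 3} prime[3] (∣n 3 refl refl) (∤n 9 refl refl) (∣-trans (∣n+ 3 9 refl refl) n+3∣lcm5) n∣lcm5)
    where open Residue n 36 _ h₃₆
  ... | suc (suc (suc _)) , s≤s (s≤s (s≤s ())) , _

  rank : ∀ k → fibProd5 n ∣ fib k ⇔ divGcds (72 * lcm5 n) (n + 4) (n + 3) ∣ k
  rank k = ⇔-trans (fibProd5∣fib⇔ 3≤n pair₀₃ pair₁₄ pair₀₄ k)
    (⇔-trans (mk⇔ (λ (L∣k , e₀₃ , _ , e₀₄) → L∣k , e₀₃ , e₀₄)
                  (λ (L∣k , e₀₃ , e₀₄) → L∣k , e₀₃ , tt , e₀₄))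
             (∣divGcds⇔ (n + 4) (n + 3) two-part three-part k))
    where
    open Residue n 12 _ h
    pair₀₃ : FibPair n (n + 3) (λ k → 2 * n ∣ k)
    pair₀₃ = fib-pair-block′ 3≤n ≤-refl prime[2] refl (∣n+ 3 3 refl refl) (∤n+ 3 6 refl refl)
    pair₁₄ : FibPair (n + 1) (n + 4) (λ _ → ⊤)
    pair₁₄ = fib-pair-coprime (m≤n⇒m≤n+o 1 3≤n) ≤-refl prime[2] (+-assoc n 1 3) (∤n+ 1 3 refl refl)
    pair₀₄ : FibPair n (n + 4) (λ k → 3 * n ∣ k)
    pair₀₄ = fib-pair-block′ 3≤n 3≤4 prime[3] refl (∣n+ 4 4 refl refl) (∤n+ 4 12 refl refl)

corollary3p3 : (n : ℕ) → 1 ≤ n →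
    ((n % 3 ≡ 1 ⊎ n % 12 ≡ 2 ⊎ n % 12 ≡ 3 ⊎ n % 12 ≡ 5 ⊎ n % 12 ≡ 6) →
       IsRankOfApparition (fibProd5 n) (lcm5 n))
    × ((n % 12 ≡ 9 ⊎ n % 12 ≡ 11) →
       IsRankOfApparition (fibProd5 n) (2 * lcm5 n))
    × (n % 12 ≡ 8 →
       IsRankOfApparition (fibProd5 n) (divGcds (72 * lcm5 n) n (n + 1)))
    × (n % 12 ≡ 0 →
       IsRankOfApparition (fibProd5 n) (divGcds (72 * lcm5 n) (n + 4) (n + 3)))
corollary3p3 n 1≤n =
    (λ residue → rank-of-⇔ L>0 (rank-lcm5 1≤n residue))
  , (λ residue → rank-of-⇔ (≤-trans L>0 (m≤m+n (lcm5 n) (1 * lcm5 n))) ([ rank-≡9[12] {n} , rank-≡11[12] {n} ]′ residue))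
  , (λ n%12≡8 → rank-of-⇔ (divGcds>0 n (n + 1) L>0) (Case≡8[12].rank n n%12≡8))
  , (λ n%12≡0 → rank-of-⇔ (divGcds>0 (n + 4) (n + 3) L>0) (Case≡0[12].rank n 1≤n n%12≡0))
  where
  L>0 : lcm5 n > 0
  L>0 = lcm5>0 1≤n
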